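{- Let $r\ge0$ be an integer, and let $G_r(z,v)=\sum_{\tau} z^{|\tau|} v^{|\rho^r(\tau)|}$, the sum over all Catalan--Stanley trees $\tau$, where $|\cdot|$ denotes the number of nodes. Then, with $T=T(z)=\frac{1-\sqrt{1-4z}}{2}$ and $S(z,t)=z+\frac{zt}{1-t-T(z)^2}$, \[ G_r(z,v) = \frac{1}{1 - z\,\frac{1-T^{2r}}{1-T^{2}}}\; S\bigg(zv,\; \frac{z\,T^{2r}}{1 - z\,\frac{1-T^{2r}}{1-T^{2}}}\,v\bigg), \] where in $S(zv,\cdot)$ the function $T$ inside $S$ is evaluated at the first argument $zv$.
   Context: A rooted plane tree has ordered children at every node. For each child $c$ of the root, the rightmost leaf of the branch at $c$ is the leaf reached from $c$ by repeatedly moving to the rightmost child. A Catalan--Stanley tree is a rooted plane tree in which every such rightmost leaf has odd distance to the root (the one-node tree is included). $S(z,t)$ is the generating function of Catalan--Stanley trees with $t$ marking these rightmost leaves and $z$ marking all other nodes. The reduction $\rho$: for each rightmost leaf $\ell$ of a branch attached to the root, if $\ell$ is a child of the root it is deleted; otherwise all descendants of the grandparent of $\ell$ are deleted (the grandparent becomes a leaf); the one-node tree is mapped to itself. $\rho^r(\tau)$ is called the $r$-fold reduced tree ($r$th ancestor) of $\tau$. $T(z)$ is the generating function of rooted plane trees by number of nodes. -}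

module Defs where

open import Data.Nat using (ℕ; zero; suc; _+_; _*_; _∸_; _/_; _%_; _≡ᵇ_)
open import Data.Nat.Combinatorics using (_C_)
open import Data.Bool using (Bool; true; false; _∧_; if_then_else_)
open import Data.List using (List; []; _∷_; mapMaybe)
open import Data.List.Relation.Unary.All using (All)
open import Data.Maybe using (Maybe; just; nothing)
open import Relation.Binary.PropositionalEquality using (_≡_)
open import Data.Product using (Σ; _×_)

data Tree : Set where
  node : List Tree → Tree

leaf : Tree
leaf = node []

mutual
  size : Tree → ℕ
  size (node ts) = suc (sizes ts)

  sizes : List Tree → ℕ
  sizes []       = 0
  sizes (t ∷ ts) = size t + sizes ts

mutual
  rdepth : Tree → ℕ
  rdepth (node [])       = 0
  rdepth (node (t ∷ ts)) = suc (rdepthLast t ts)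

  rdepthLast : Tree → List Tree → ℕ
  rdepthLast t []       = rdepth t
  rdepthLast t (u ∷ us) = rdepthLast u us

-- For a child c of the root, the rightmost leaf of the branch at c has
-- distance suc (rdepth c) to the root.
-- Catalan--Stanley trees: every such distance is odd (the one-node tree
-- satisfies this vacuously).
CatalanStanley : Tree → Set
CatalanStanley (node cs) = All (λ c → suc (rdepth c) % 2 ≡ 1) cs

mutual
  cut : ℕ → Tree → Tree
  cut zero    t               = leaf
  cut (suc j) (node [])       = leaf
  cut (suc j) (node (t ∷ ts)) = node (cutLast j t ts)

  cutLast : ℕ → Tree → List Tree → List Tree
  cutLast j t []       = cut j t ∷ []
  cutLast j t (u ∷ us) = t ∷ cutLast j u us

-- If the rightmost leaf ℓ is c itself (rdepth c = 0) the branch is deleted;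
-- otherwise ℓ is at step rdepth c from c, its grandparent is at step
-- rdepth c ∸ 2 from c, and all descendants of the grandparent are deleted.
-- (The case rdepth c = 1, where the grandparent would be the root, never
-- occurs for Catalan--Stanley trees; there we use an arbitrary convention.)
reduceBranch : Tree → Maybe Tree
reduceBranch c with rdepth c
... | zero  = nothing
... | suc k = just (cut (suc k ∸ 2) c)

ρ : Tree → Tree
ρ (node cs) = node (mapMaybe reduceBranch cs)

ρ^ : ℕ → Tree → Tree
ρ^ zero    τ = τ
ρ^ (suc r) τ = ρ (ρ^ r τ)

-- Formal power series in z, v with natural coefficients:
-- F n m = [z^n v^m] F

PS : Set
PS = ℕ → ℕ → ℕ

sumTo : ℕ → (ℕ → ℕ) → ℕ
sumTo zero    f = f 0
sumTo (suc n) f = sumTo n f + f (suc n)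

mono : ℕ → ℕ → PS
mono a b n m = if (n ≡ᵇ a) ∧ (m ≡ᵇ b) then 1 else 0

𝟙 : PS
𝟙 = mono 0 0

Z : PS
Z = mono 1 0

V : PS
V = mono 0 1

ZV : PS
ZV = mono 1 1

infixl 6 _⊕_
infixl 7 _⊗_

_⊕_ : PS → PS → PS
(f ⊕ g) n m = f n m + g n m

_⊗_ : PS → PS → PS
(f ⊗ g) n m = sumTo n (λ i → sumTo m (λ j → f i j * g (n ∸ i) (m ∸ j)))

_^ᵖ_ : PS → ℕ → PS
f ^ᵖ zero  = 𝟙
f ^ᵖ suc k = f ⊗ (f ^ᵖ k)

-- 1/(1 - X) = Σ_k X^k, for X with no z^0 terms (then X^k contributes to
-- z^n only for k ≤ n, so the sum below is the full geometric series).
geom : PS → PS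
geom X n m = sumTo n (λ k → (X ^ᵖ k) n m)

sumPS : ℕ → (ℕ → PS) → PS
sumPS zero    F = λ _ _ → 0
sumPS (suc r) F = sumPS r F ⊕ F r

-- T(z) = (1 - √(1-4z))/2 : [z^0]T = 0, [z^(n+1)]T = Catalan n = (2n C n)/(n+1)

Tcoeff : ℕ → ℕ
Tcoeff zero    = 0
Tcoeff (suc n) = ((2 * n) C n) / suc n

Tz : PS
Tz n zero    = Tcoeff n
Tz n (suc m) = 0

Tzv : PS
Tzv n m = if n ≡ᵇ m then Tcoeff n else 0

S[zv,_] : PS → PS
S[zv, W ] = ZV ⊕ ZV ⊗ W ⊗ geom (W ⊕ Tzv ⊗ Tzv)

-- (1 - T^{2r})/(1 - T^2) = Σ_{j<r} T^{2j}
A : ℕ → PS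
A r = sumPS r (λ j → Tz ^ᵖ (2 * j))

Q : ℕ → PS
Q r = geom (Z ⊗ A r)

RHS : ℕ → PS
RHS r = Q r ⊗ S[zv, Z ⊗ (Tz ^ᵖ (2 * r)) ⊗ Q r ⊗ V ]

GrSet : ℕ → ℕ → ℕ → Set
GrSet r n m = Σ Tree (λ τ → CatalanStanley τ × (size τ ≡ n × size (ρ^ r τ) ≡ m))

-- Every power series of the statement is read as a weighted class (objects with a
-- z-weight and a v-weight), and "F Counts C" exhibits each coefficient [z^n v^m] F as a
-- bijection with the objects of C of weights (n, m).  T(z) counts plane trees by size, via the ballot numbers
-- (ballot 1 n · (n+1) = C(2n, n)).
--
-- A Catalan--Stanley tree is a root with a sequence of branches whose rightmost paths
-- carry an even number of "left parts", i.e. a list of pairs of trees; ρ^r removes the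
-- last r pairs of every branch and deletes the branches with fewer than r pairs.  So a
-- branch is short (z A_r with A_r = Σ_{j<r} T^{2j}) or long (z T^{2r} v SEQ(T(zv)^2)),
-- and regrouping the sequence of branches around the long ones gives exactly the class
-- of the right-hand side (RHS≅CatalanStanley), from which mainTheorem6 is read off.
module Submission where

open import Defs
open import Data.Nat using (ℕ; zero; suc; _+_; _*_; _∸_; _/_; _%_; _≤_; _<_; _≤?_; z≤n; s≤s; _≡ᵇ_)
open import Data.Nat.Properties
open import Data.Nat.DivMod using (m*n/n≡m)
open import Data.Nat.ListAction using (sum)
open import Data.Nat.ListAction.Properties using (sum-++)
open import Data.Nat.Tactic.RingSolver using (solve-∀)
open import Data.Bool using (true; false; T)
open import Data.Fin using (Fin)
open import Data.Fin.Properties using (+↔⊎; *↔×)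
open import Data.Vec using (Vec; []; _∷_; replicate)
open import Data.List using (List; []; _∷_; _++_; [_]; _∷ʳ_; length; map; mapMaybe; initLast; _∷ʳ′_)
open import Data.List.Properties using (map-∘; map-cong; map-id; map-++; ++-assoc; ++-identityʳ; length-++)
open import Data.List.Relation.Unary.All using (All; []; _∷_)
open import Data.Maybe using (Maybe; just; nothing; maybe; _>>=_)
open import Data.Product using (Σ; _×_; _,_; proj₁; proj₂)
open import Data.Sum using (_⊎_; inj₁; inj₂)
open import Data.Unit using (⊤; tt)
open import Data.Empty using (⊥; ⊥-elim)
open import Relation.Nullary using (¬_; yes; no)
open import Relation.Binary.PropositionalEquality using (_≡_; refl; sym; trans; cong; cong₂; subst; module ≡-Reasoning)
open import Function.Bundles using (_↔_; mk↔ₛ′)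
open import Function.Properties.Inverse using (↔-sym; ↔-trans)
open import Data.Product.Function.NonDependent.Propositional using (_×-↔_)
open import Data.Sum.Function.Propositional using (_⊎-↔_)

record Class : Set₁ where
  constructor mkClass
  field
    Carrier : Set
    zw      : Carrier → ℕ
    vw      : Carrier → ℕ
open Class

Fibre : Class → ℕ → ℕ → Set
Fibre C n m = Σ (Carrier C) λ x → zw C x ≡ n × vw C x ≡ m

infix 4 _Counts_
_Counts_ : PS → Class → Set
F Counts C = ∀ n m → Fin (F n m) ↔ Fibre C n m

fibre-≡ : ∀ {C n m} {x y : Carrier C} → x ≡ y →
          (p : zw C x ≡ n × vw C x ≡ m) (q : zw C y ≡ n × vw C y ≡ m) →
          _≡_ {A = Fibre C n m} (x , p) (y , q)
fibre-≡ refl (a , b) (c , d) = cong₂ (λ a b → _ , a , b) (≡-irrelevant a c) (≡-irrelevant b d)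

infix 3 _≅_
record _≅_ (C D : Class) : Set where
  constructor mk≅
  field
    to      : Carrier C → Carrier D
    from    : Carrier D → Carrier C
    to-from : ∀ y → to (from y) ≡ y
    from-to : ∀ x → from (to x) ≡ x
    zw-to   : ∀ x → zw D (to x) ≡ zw C x
    vw-to   : ∀ x → vw D (to x) ≡ vw C x

≅-refl : ∀ {C} → C ≅ C
≅-refl = mk≅ (λ x → x) (λ x → x) (λ _ → refl) (λ _ → refl) (λ _ → refl) (λ _ → refl)

≅-sym : ∀ {C D} → C ≅ D → D ≅ C
≅-sym {C} {D} e = mk≅ from to from-to to-from
  (λ y → trans (sym (zw-to (from y))) (cong (zw D) (to-from y)))
  (λ y → trans (sym (vw-to (from y))) (cong (vw D) (to-from y)))
  where open _≅_ e

≅-trans : ∀ {C D E} → C ≅ D → D ≅ E → C ≅ E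
≅-trans e f = mk≅ (λ x → F.to (E.to x)) (λ y → E.from (F.from y))
  (λ y → trans (cong F.to (E.to-from (F.from y))) (F.to-from y))
  (λ x → trans (cong E.from (F.from-to (E.to x))) (E.from-to x))
  (λ x → trans (F.zw-to (E.to x)) (E.zw-to x))
  (λ x → trans (F.vw-to (E.to x)) (E.vw-to x))
  where module E = _≅_ e
        module F = _≅_ f

fibre-≅ : ∀ {C D} → C ≅ D → ∀ n m → Fibre C n m ↔ Fibre D n m
fibre-≅ {C} {D} e n m = mk↔ₛ′
  (λ { (x , p , q) → to x , trans (zw-to x) p , trans (vw-to x) q })
  (λ { (y , p , q) → from y , trans (zw-from y) p , trans (vw-from y) q })
  (λ { (y , _) → fibre-≡ {D} (to-from y) _ _ })
  (λ { (x , _) → fibre-≡ {C} (from-to x) _ _ })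
  where
  open _≅_ e
  open _≅_ (≅-sym e) using () renaming (zw-to to zw-from; vw-to to vw-from)

counts-≅ : ∀ {F C D} → F Counts C → C ≅ D → F Counts D
counts-≅ c e n m = ↔-trans (c n m) (fibre-≅ e n m)

unitC : ℕ → ℕ → Class
unitC a b = mkClass ⊤ (λ _ → a) (λ _ → b)

∅C : Class
∅C = mkClass ⊥ (λ ()) (λ ())

infixl 6 _⊎C_
infixl 7 _×C_

_⊎C_ : Class → Class → Class
C ⊎C D = mkClass (Carrier C ⊎ Carrier D)
  (λ { (inj₁ x) → zw C x ; (inj₂ y) → zw D y })
  (λ { (inj₁ x) → vw C x ; (inj₂ y) → vw D y })

_×C_ : Class → Class → Class
C ×C D = mkClass (Carrier C × Carrier D)
  (λ { (x , y) → zw C x + zw D y })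
  (λ { (x , y) → vw C x + vw D y })

powC : Class → ℕ → Class
powC C zero    = unitC 0 0
powC C (suc k) = C ×C powC C k

sumC : ℕ → (ℕ → Class) → Class
sumC zero    F = ∅C
sumC (suc r) F = sumC r F ⊎C F r

listC : Class → Class
listC C = mkClass (List (Carrier C)) (λ xs → sum (map (zw C) xs)) (λ xs → sum (map (vw C) xs))

zw-++ : ∀ C xs ys → zw (listC C) (xs ++ ys) ≡ zw (listC C) xs + zw (listC C) ys
zw-++ C xs ys = trans (cong sum (map-++ (zw C) xs ys)) (sum-++ (map (zw C) xs) _)

-- A class has positive z-weights; this makes its sequence class finite in each degree.
Positive : Class → Set
Positive C = ∀ x → 1 ≤ zw C x

single↔ : {B : Set} (b : B) → (∀ y → b ≡ y) → Fin 1 ↔ B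
single↔ b unique = mk↔ₛ′ (λ _ → b) (λ _ → Fin.zero) unique (λ { Fin.zero → refl ; (Fin.suc ()) })

empty↔ : {A B : Set} → ¬ A → ¬ B → A ↔ B
empty↔ ¬a ¬b = mk↔ₛ′ (λ a → ⊥-elim (¬a a)) (λ b → ⊥-elim (¬b b))
                     (λ b → ⊥-elim (¬b b)) (λ a → ⊥-elim (¬a a))

≡ᵇ-true⇒≡ : ∀ {m n} → (m ≡ᵇ n) ≡ true → m ≡ n
≡ᵇ-true⇒≡ {m} {n} e = ≡ᵇ⇒≡ m n (subst T (sym e) tt)

≡ᵇ-false⇒≢ : ∀ {m n} → (m ≡ᵇ n) ≡ false → ¬ m ≡ n
≡ᵇ-false⇒≢ {m} {n} e m≡n = subst T e (≡⇒≡ᵇ m n m≡n)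

counts-unit : ∀ a b → mono a b Counts unitC a b
counts-unit a b n m with n ≡ᵇ a in p | m ≡ᵇ b in q
... | true  | true  with refl ← ≡ᵇ-true⇒≡ {n} p | refl ← ≡ᵇ-true⇒≡ {m} q =
  single↔ (tt , refl , refl) (λ { (tt , p , q) → fibre-≡ {unitC a b} refl _ _ })
... | true  | false = empty↔ (λ ()) (λ { (tt , _ , e) → ≡ᵇ-false⇒≢ q (sym e) })
... | false | _     = empty↔ (λ ()) (λ { (tt , e , _) → ≡ᵇ-false⇒≢ p (sym e) })

counts-∅ : (λ _ _ → 0) Counts ∅C
counts-∅ n m = empty↔ (λ ()) (λ { (() , _) })

counts-⊎ : ∀ {F G C D} → F Counts C → G Counts D → F ⊕ G Counts C ⊎C D
counts-⊎ {C = C} {D} cF cG n m = ↔-trans +↔⊎ (↔-trans (cF n m ⊎-↔ cG n m) (↔-sym split))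
  where
  split : Fibre (C ⊎C D) n m ↔ (Fibre C n m ⊎ Fibre D n m)
  split = mk↔ₛ′
    (λ { (inj₁ x , p) → inj₁ (x , p) ; (inj₂ y , p) → inj₂ (y , p) })
    (λ { (inj₁ (x , p)) → inj₁ x , p ; (inj₂ (y , p)) → inj₂ y , p })
    (λ { (inj₁ _) → refl ; (inj₂ _) → refl })
    (λ { (inj₁ _ , _) → refl ; (inj₂ _ , _) → refl })

counts-sum : ∀ {F : ℕ → PS} {C : ℕ → Class} → (∀ j → F j Counts C j) → ∀ r → sumPS r F Counts sumC r C
counts-sum c zero    = counts-∅
counts-sum c (suc r) = counts-⊎ (counts-sum c r) (c r)

Upto : ℕ → (ℕ → Set) → Set
Upto n X = Σ ℕ λ i → i ≤ n × X i

Upto-suc : ∀ n (X : ℕ → Set) → (Upto n X ⊎ X (suc n)) ↔ Upto (suc n) X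
Upto-suc n X = mk↔ₛ′ to from to-from from-to
  where
  to : Upto n X ⊎ X (suc n) → Upto (suc n) X
  to (inj₁ (i , i≤n , x)) = i , m≤n⇒m≤1+n i≤n , x
  to (inj₂ x)             = suc n , ≤-refl , x
  from : Upto (suc n) X → Upto n X ⊎ X (suc n)
  from (i , i≤1+n , x) with i ≤? n
  ... | yes i≤n = inj₁ (i , i≤n , x)
  ... | no  i≰n with refl ← ≤-antisym i≤1+n (≰⇒> i≰n) = inj₂ x
  to-from : ∀ y → to (from y) ≡ y
  to-from (i , i≤1+n , x) with i ≤? n
  ... | yes _   = cong (λ p → i , p , x) (≤-irrelevant _ _)
  ... | no  i≰n with refl ← ≤-antisym i≤1+n (≰⇒> i≰n) = cong (λ p → suc n , p , x) (≤-irrelevant _ _)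
  from-to : ∀ x → from (to x) ≡ x
  from-to (inj₁ (i , i≤n , x)) with i ≤? n
  ... | yes _   = cong (λ p → inj₁ (i , p , x)) (≤-irrelevant _ _)
  ... | no  i≰n = ⊥-elim (i≰n i≤n)
  from-to (inj₂ x) with suc n ≤? n
  ... | yes 1+n≤n = ⊥-elim (1+n≰n 1+n≤n)
  ... | no  i≰n with ≤-antisym (≤-refl {suc n}) (≰⇒> i≰n)
  ... | e rewrite ≡-irrelevant e refl = refl

sumTo-↔ : ∀ n (h : ℕ → ℕ) (X : ℕ → Set) → (∀ i → Fin (h i) ↔ X i) → Fin (sumTo n h) ↔ Upto n X
sumTo-↔ zero    h X e = ↔-trans (e 0) (mk↔ₛ′ (λ x → 0 , z≤n , x) (λ { (_ , z≤n , x) → x })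
                                              (λ { (_ , z≤n , x) → refl }) (λ _ → refl))
sumTo-↔ (suc n) h X e = ↔-trans +↔⊎ (↔-trans (sumTo-↔ n h X e ⊎-↔ e (suc n)) (Upto-suc n X))

fibre-× : ∀ C D n m →
          Fibre (C ×C D) n m ↔ Upto n (λ i → Upto m (λ j → Fibre C i j × Fibre D (n ∸ i) (m ∸ j)))
fibre-× C D n m = mk↔ₛ′ to from to-from from-to
  where
  rest : ∀ {a b c} → a + b ≡ c → b ≡ c ∸ a
  rest {a} {b} refl = sym (m+n∸m≡n a b)
  bound : ∀ {a b c} → a + b ≡ c → a ≤ c
  bound {a} {b} refl = m≤m+n a b
  to : Fibre (C ×C D) n m → Upto n (λ i → Upto m (λ j → Fibre C i j × Fibre D (n ∸ i) (m ∸ j)))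
  to ((x , y) , p , q) = zw C x , bound p , vw C x , bound q , (x , refl , refl) , (y , rest p , rest q)
  from : Upto n (λ i → Upto m (λ j → Fibre C i j × Fibre D (n ∸ i) (m ∸ j))) → Fibre (C ×C D) n m
  from (i , i≤n , j , j≤m , (x , px , qx) , (y , py , qy)) =
    (x , y) , trans (cong₂ _+_ px py) (m+[n∸m]≡n i≤n) , trans (cong₂ _+_ qx qy) (m+[n∸m]≡n j≤m)
  same : ∀ {i j x y} (px : zw C x ≡ i) (qx : vw C x ≡ j) (b b' : i ≤ n) (c c' : j ≤ m)
           (p p' : zw D y ≡ n ∸ i) (q q' : vw D y ≡ m ∸ j) →
         _≡_ {A = Upto n (λ i → Upto m (λ j → Fibre C i j × Fibre D (n ∸ i) (m ∸ j)))}
             (i , b , j , c , (x , px , qx) , (y , p , q)) (i , b' , j , c' , (x , px , qx) , (y , p' , q'))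
  same px qx b b' c c' p p' q q'
    rewrite ≤-irrelevant b b' | ≤-irrelevant c c' | ≡-irrelevant p p' | ≡-irrelevant q q' = refl
  to-from : ∀ s → to (from s) ≡ s
  to-from (i , i≤n , j , j≤m , (x , refl , refl) , (y , py , qy)) = same refl refl _ _ _ _ _ _ _ _
  from-to : ∀ s → from (to s) ≡ s
  from-to ((x , y) , _) = fibre-≡ {C ×C D} refl _ _

counts-× : ∀ {F G C D} → F Counts C → G Counts D → F ⊗ G Counts C ×C D
counts-× {C = C} {D} cF cG n m =
  ↔-trans (sumTo-↔ n _ _ λ i → sumTo-↔ m _ _ λ j → ↔-trans *↔× (cF i j ×-↔ cG (n ∸ i) (m ∸ j)))
          (↔-sym (fibre-× C D n m))

counts-pow : ∀ {F C} → F Counts C → ∀ k → F ^ᵖ k Counts powC C k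
counts-pow c zero    = counts-unit 0 0
counts-pow c (suc k) = counts-× c (counts-pow c k)

-- Sequences of length k are the k-th power; positivity bounds the length by the z-weight.
module Sequences (C : Class) where

  powToList : ∀ k → Carrier (powC C k) → List (Carrier C)
  powToList zero    tt       = []
  powToList (suc k) (x , xs) = x ∷ powToList k xs

  listToPow : (xs : List (Carrier C)) → Carrier (powC C (length xs))
  listToPow []       = tt
  listToPow (x ∷ xs) = x , listToPow xs

  length-powToList : ∀ k xs → length (powToList k xs) ≡ k
  length-powToList zero    tt       = refl
  length-powToList (suc k) (x , xs) = cong suc (length-powToList k xs)

  zw-powToList : ∀ k xs → zw (listC C) (powToList k xs) ≡ zw (powC C k) xs
  zw-powToList zero    tt       = refl
  zw-powToList (suc k) (x , xs) = cong (zw C x +_) (zw-powToList k xs)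

  vw-powToList : ∀ k xs → vw (listC C) (powToList k xs) ≡ vw (powC C k) xs
  vw-powToList zero    tt       = refl
  vw-powToList (suc k) (x , xs) = cong (vw C x +_) (vw-powToList k xs)

  powToList-listToPow : ∀ xs → powToList (length xs) (listToPow xs) ≡ xs
  powToList-listToPow []       = refl
  powToList-listToPow (x ∷ xs) = cong (x ∷_) (powToList-listToPow xs)

  listToPow-powToList : ∀ k xs → _≡_ {A = Σ ℕ λ k → Carrier (powC C k)}
                                     (length (powToList k xs) , listToPow (powToList k xs)) (k , xs)
  listToPow-powToList zero    tt       = refl
  listToPow-powToList (suc k) (x , xs) = cong (λ { (k , xs) → suc k , (x , xs) }) (listToPow-powToList k xs)

  length≤zw : Positive C → ∀ xs → length xs ≤ zw (listC C) xs
  length≤zw pos []       = z≤n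
  length≤zw pos (x ∷ xs) = +-mono-≤ (pos x) (length≤zw pos xs)

  fibre-list : Positive C → ∀ n m → Fibre (listC C) n m ↔ Upto n (λ k → Fibre (powC C k) n m)
  fibre-list pos n m = mk↔ₛ′ to from to-from from-to
    where
    to : Fibre (listC C) n m → Upto n (λ k → Fibre (powC C k) n m)
    to (xs , p , q) = length xs , subst (length xs ≤_) p (length≤zw pos xs) , listToPow xs
      , trans (sym (zw-powToList (length xs) (listToPow xs))) (trans (cong (zw (listC C)) (powToList-listToPow xs)) p)
      , trans (sym (vw-powToList (length xs) (listToPow xs))) (trans (cong (vw (listC C)) (powToList-listToPow xs)) q)
    from : Upto n (λ k → Fibre (powC C k) n m) → Fibre (listC C) n m
    from (k , _ , xs , p , q) = powToList k xs , trans (zw-powToList k xs) p , trans (vw-powToList k xs) q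
    same : ∀ {k k' xs xs'} → _≡_ {A = Σ ℕ λ k → Carrier (powC C k)} (k , xs) (k' , xs') →
           ∀ b b' p p' q q' →
           _≡_ {A = Upto n (λ k → Fibre (powC C k) n m)} (k , b , xs , p , q) (k' , b' , xs' , p' , q')
    same refl b b' p p' q q' rewrite ≤-irrelevant b b' | ≡-irrelevant p p' | ≡-irrelevant q q' = refl
    to-from : ∀ s → to (from s) ≡ s
    to-from (k , _ , xs , _) = same (listToPow-powToList k xs) _ _ _ _ _ _
    from-to : ∀ s → from (to s) ≡ s
    from-to (xs , _) = fibre-≡ {listC C} (powToList-listToPow xs) _ _

counts-list : ∀ {F C} → Positive C → F Counts C → geom F Counts listC C
counts-list {C = C} pos c n m =
  ↔-trans (sumTo-↔ n _ _ λ k → counts-pow c k n m) (↔-sym (Sequences.fibre-list C pos n m))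

×-cong : ∀ {A A' B B'} → A ≅ A' → B ≅ B' → A ×C B ≅ A' ×C B'
×-cong e f = mk≅ (λ { (x , y) → E.to x , F.to y }) (λ { (x , y) → E.from x , F.from y })
  (λ { (x , y) → cong₂ _,_ (E.to-from x) (F.to-from y) })
  (λ { (x , y) → cong₂ _,_ (E.from-to x) (F.from-to y) })
  (λ { (x , y) → cong₂ _+_ (E.zw-to x) (F.zw-to y) })
  (λ { (x , y) → cong₂ _+_ (E.vw-to x) (F.vw-to y) })
  where module E = _≅_ e
        module F = _≅_ f

⊎-cong : ∀ {A A' B B'} → A ≅ A' → B ≅ B' → A ⊎C B ≅ A' ⊎C B'
⊎-cong e f = mk≅
  (λ { (inj₁ x) → inj₁ (E.to x)   ; (inj₂ y) → inj₂ (F.to y) })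
  (λ { (inj₁ x) → inj₁ (E.from x) ; (inj₂ y) → inj₂ (F.from y) })
  (λ { (inj₁ x) → cong inj₁ (E.to-from x) ; (inj₂ y) → cong inj₂ (F.to-from y) })
  (λ { (inj₁ x) → cong inj₁ (E.from-to x) ; (inj₂ y) → cong inj₂ (F.from-to y) })
  (λ { (inj₁ x) → E.zw-to x ; (inj₂ y) → F.zw-to y })
  (λ { (inj₁ x) → E.vw-to x ; (inj₂ y) → F.vw-to y })
  where module E = _≅_ e
        module F = _≅_ f

list-cong : ∀ {A B} → A ≅ B → listC A ≅ listC B
list-cong {A} {B} e = mk≅ (map to) (map from)
  (λ ys → trans (sym (map-∘ ys)) (trans (map-cong to-from ys) (map-id ys)))
  (λ xs → trans (sym (map-∘ xs)) (trans (map-cong from-to xs) (map-id xs)))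
  (λ xs → cong sum (trans (sym (map-∘ xs)) (map-cong zw-to xs)))
  (λ xs → cong sum (trans (sym (map-∘ xs)) (map-cong vw-to xs)))
  where
  open _≅_ e

sum-cong : ∀ {F G : ℕ → Class} → (∀ j → F j ≅ G j) → ∀ r → sumC r F ≅ sumC r G
sum-cong e zero    = ≅-refl
sum-cong e (suc r) = ⊎-cong (sum-cong e r) (e r)

×-assoc : ∀ {A B C} → (A ×C B) ×C C ≅ A ×C (B ×C C)
×-assoc {A} {B} {C} = mk≅ (λ { ((a , b) , c) → a , (b , c) }) (λ { (a , (b , c)) → (a , b) , c })
  (λ _ → refl) (λ _ → refl)
  (λ { ((a , b) , c) → sym (+-assoc (zw A a) (zw B b) (zw C c)) })
  (λ { ((a , b) , c) → sym (+-assoc (vw A a) (vw B b) (vw C c)) })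

⊎-comm : ∀ {A B} → A ⊎C B ≅ B ⊎C A
⊎-comm = mk≅ swap swap
  (λ { (inj₁ _) → refl ; (inj₂ _) → refl }) (λ { (inj₁ _) → refl ; (inj₂ _) → refl })
  (λ { (inj₁ _) → refl ; (inj₂ _) → refl }) (λ { (inj₁ _) → refl ; (inj₂ _) → refl })
  where
  swap : ∀ {X Y : Set} → X ⊎ Y → Y ⊎ X
  swap (inj₁ x) = inj₂ x
  swap (inj₂ y) = inj₁ y

module ≅-Reasoning where
  infixr 2 _≅⟨_⟩_
  infix  3 _∎

  _≅⟨_⟩_ : ∀ A {B C} → A ≅ B → B ≅ C → A ≅ C
  A ≅⟨ e ⟩ f = ≅-trans e f

  _∎ : ∀ A → A ≅ A
  A ∎ = ≅-refl

pow-pairs : ∀ {C} j → powC (C ×C C) j ≅ powC C (2 * j)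
pow-pairs zero            = ≅-refl
pow-pairs {C} (suc j) rewrite +-suc j (j + 0) =
  ≅-trans (×-cong ≅-refl (pow-pairs j)) (×-assoc {C} {C} {powC C (2 * j)})

list-unfold : ∀ {C} → unitC 0 0 ⊎C C ×C listC C ≅ listC C
list-unfold = mk≅ (λ { (inj₁ tt) → [] ; (inj₂ (x , xs)) → x ∷ xs })
  (λ { [] → inj₁ tt ; (x ∷ xs) → inj₂ (x , xs) })
  (λ { [] → refl ; (_ ∷ _) → refl }) (λ { (inj₁ _) → refl ; (inj₂ _) → refl })
  (λ { (inj₁ _) → refl ; (inj₂ _) → refl }) (λ { (inj₁ _) → refl ; (inj₂ _) → refl })

module Runs (S B : Class) where

  Blocks : Set
  Blocks = List (Carrier B × List (Carrier S))

  interleave : List (Carrier S) → Blocks → List (Carrier S ⊎ Carrier B)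
  interleave (s ∷ ss) bs            = inj₁ s ∷ interleave ss bs
  interleave []       []            = []
  interleave []       ((b , ss) ∷ bs) = inj₂ b ∷ interleave ss bs

  runs : List (Carrier S ⊎ Carrier B) → List (Carrier S) × Blocks
  runs []           = [] , []
  runs (inj₁ s ∷ w) = s ∷ proj₁ (runs w) , proj₂ (runs w)
  runs (inj₂ b ∷ w) = [] , (b , proj₁ (runs w)) ∷ proj₂ (runs w)

  interleave-runs : ∀ w → interleave (proj₁ (runs w)) (proj₂ (runs w)) ≡ w
  interleave-runs []           = refl
  interleave-runs (inj₁ s ∷ w) = cong (inj₁ s ∷_) (interleave-runs w)
  interleave-runs (inj₂ b ∷ w) = cong (inj₂ b ∷_) (interleave-runs w)

  runs-interleave : ∀ ss bs → runs (interleave ss bs) ≡ (ss , bs)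
  runs-interleave (s ∷ ss) bs              = cong (λ { (ss , bs) → s ∷ ss , bs }) (runs-interleave ss bs)
  runs-interleave []       []              = refl
  runs-interleave []       ((b , ss) ∷ bs) = cong (λ { (ss , bs) → [] , (b , ss) ∷ bs }) (runs-interleave ss bs)

  zw-interleave : ∀ ss bs →
                  zw (listC (S ⊎C B)) (interleave ss bs) ≡ zw (listC S ×C listC (B ×C listC S)) (ss , bs)
  zw-interleave (s ∷ ss) bs              = trans (cong (zw S s +_) (zw-interleave ss bs)) (sym (+-assoc (zw S s) _ _))
  zw-interleave []       []              = refl
  zw-interleave []       ((b , ss) ∷ bs) = trans (cong (zw B b +_) (zw-interleave ss bs)) (sym (+-assoc (zw B b) _ _))

  vw-interleave : ∀ ss bs →
                  vw (listC (S ⊎C B)) (interleave ss bs) ≡ vw (listC S ×C listC (B ×C listC S)) (ss , bs)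
  vw-interleave (s ∷ ss) bs              = trans (cong (vw S s +_) (vw-interleave ss bs)) (sym (+-assoc (vw S s) _ _))
  vw-interleave []       []              = refl
  vw-interleave []       ((b , ss) ∷ bs) = trans (cong (vw B b +_) (vw-interleave ss bs)) (sym (+-assoc (vw B b) _ _))

  list-⊎ : listC S ×C listC (B ×C listC S) ≅ listC (S ⊎C B)
  list-⊎ = mk≅ (λ { (ss , bs) → interleave ss bs }) runs interleave-runs
    (λ { (ss , bs) → runs-interleave ss bs })
    (λ { (ss , bs) → zw-interleave ss bs }) (λ { (ss , bs) → vw-interleave ss bs })

open Runs using (list-⊎)

group : ∀ W P → W ×C listC (W ⊎C P) ≅ (W ×C listC P) ×C listC (W ×C listC P)
group W P = ≅-trans (×-cong ≅-refl (≅-trans (list-cong ⊎-comm) (≅-sym (list-⊎ P W))))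
                    (≅-sym (×-assoc {W} {listC P} {listC (W ×C listC P)}))

-- The number of plane trees with n+1 nodes is the Catalan number C(2n, n)/(n+1),
-- obtained from the ballot numbers by binomial-coefficient arithmetic.
module Catalan where

  open import Data.Nat.Combinatorics using (_C_; nCk+nC[k+1]≡[n+1]C[k+1]; nCk≡nC[n∸k]; k>n⇒nCk≡0; nC1≡n)

  -- ballot h n: the number of h-tuples of forests with n nodes in total.  The first
  -- forest is either empty, or its first tree splits into that tree's subtrees
  -- and the remaining forest, giving an (h+2)-tuple with one node less.
  ballot : ℕ → ℕ → ℕ
  ballot zero    zero    = 1
  ballot zero    (suc n) = 0
  ballot (suc h) zero    = 1
  ballot (suc h) (suc n) = ballot h (suc n) + ballot (suc (suc h)) n

  C⁻ : ℕ → ℕ → ℕ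
  C⁻ a zero    = 0
  C⁻ a (suc k) = a C k

  pascal : ∀ a k → a C k + a C suc k ≡ suc a C suc k
  pascal = nCk+nC[k+1]≡[n+1]C[k+1]

  pascal⁻ : ∀ a k → suc a C k ≡ C⁻ a k + a C k
  pascal⁻ a zero    = refl
  pascal⁻ a (suc k) = sym (pascal a k)

  absorption : ∀ m k → suc k * (suc m C suc k) ≡ suc m * (m C k)
  absorption zero    zero    = refl
  absorption zero    (suc k)
    rewrite k>n⇒nCk≡0 {1} {suc (suc k)} (s≤s (s≤s z≤n)) | k>n⇒nCk≡0 {0} {suc k} (s≤s z≤n) =
    *-zeroʳ (suc (suc k))
  absorption (suc m) zero    rewrite nC1≡n (suc (suc m)) =
    trans (+-identityʳ (suc (suc m))) (cong (λ x → suc (suc x)) (sym (*-identityʳ m)))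
  absorption (suc m) (suc k) =
    begin
      suc (suc k) * (suc (suc m) C suc (suc k))
        ≡⟨ cong (suc (suc k) *_) (sym (pascal (suc m) (suc k))) ⟩
      suc (suc k) * (a + b)
        ≡⟨ distribute k a b ⟩
      a + suc k * a + suc (suc k) * b
        ≡⟨ cong₂ (λ x y → a + x + y) (absorption m k) (absorption m (suc k)) ⟩
      a + suc m * (m C k) + suc m * (m C suc k)
        ≡⟨ +-assoc a _ _ ⟩
      a + (suc m * (m C k) + suc m * (m C suc k))
        ≡⟨ cong (a +_) (sym (*-distribˡ-+ (suc m) (m C k) _)) ⟩
      a + suc m * (m C k + m C suc k)
        ≡⟨ cong (λ x → a + suc m * x) (pascal m k) ⟩
      a + suc m * a
        ∎
    where
    open ≡-Reasoning
    a = suc m C suc k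
    b = suc m C suc (suc k)
    distribute : ∀ k a b → suc (suc k) * (a + b) ≡ a + suc k * a + suc (suc k) * b
    distribute = solve-∀

  middle-symmetry : ∀ {n M} → M ≡ n + n + 1 → M C suc n ≡ M C n
  middle-symmetry {n} refl = trans (nCk≡nC[n∸k] le) (cong ((n + n + 1) C_) eq)
    where
    row : n + n + 1 ≡ suc n + n
    row = +-comm (n + n) 1
    eq : n + n + 1 ∸ suc n ≡ n
    eq = trans (cong (_∸ suc n) row) (m+n∸m≡n (suc n) n)
    le : suc n ≤ n + n + 1
    le = subst (suc n ≤_) (sym row) (m≤m+n (suc n) n)

  pascal-step : ∀ M n X Y → X + M C n ≡ M C suc n → Y + C⁻ M n ≡ M C n →
                X + Y + suc M C n ≡ suc M C suc n
  pascal-step M n X Y p q =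
    begin
      X + Y + suc M C n            ≡⟨ cong (X + Y +_) (pascal⁻ M n) ⟩
      X + Y + (C⁻ M n + M C n)     ≡⟨ interchange X Y (C⁻ M n) (M C n) ⟩
      (X + M C n) + (Y + C⁻ M n)   ≡⟨ cong₂ _+_ p q ⟩
      M C suc n + M C n            ≡⟨ +-comm (M C suc n) _ ⟩
      M C n + M C suc n            ≡⟨ pascal M n ⟩
      suc M C suc n                ∎
    where
    open ≡-Reasoning
    interchange : ∀ x y a b → x + y + (a + b) ≡ (x + b) + (y + a)
    interchange = solve-∀

  -- Ballot formula: ballot (h+1) n = C(2n+h, n) - C(2n+h, n-1), stated subtraction-free
  -- and for any M equal to 2n+h, so that the recursion can peel a successor off M.
  ballot-formula : ∀ h n M → M ≡ n + n + h → ballot (suc h) n + C⁻ M n ≡ M C n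
  ballot-formula h       zero    M       _  = refl
  ballot-formula zero    (suc n) (suc M) eq =
    pascal-step M n 0 (ballot 2 n) (sym (middle-symmetry M≡)) (ballot-formula 1 n M M≡)
    where
    shift : ∀ n → suc n + suc n + 0 ≡ suc (n + n + 1)
    shift = solve-∀
    M≡ : M ≡ n + n + 1
    M≡ = suc-injective (trans eq (shift n))
  ballot-formula (suc h) (suc n) (suc M) eq =
    pascal-step M n _ _ (ballot-formula h (suc n) M M≡₁) (ballot-formula (suc (suc h)) n M M≡₂)
    where
    shift₁ : ∀ n h → suc n + suc n + suc h ≡ suc (suc n + suc n + h)
    shift₁ = solve-∀
    shift₂ : ∀ n h → suc n + suc n + h ≡ n + n + suc (suc h)
    shift₂ = solve-∀
    M≡₁ : M ≡ suc n + suc n + h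
    M≡₁ = suc-injective (trans eq (shift₁ n h))
    M≡₂ : M ≡ n + n + suc (suc h)
    M≡₂ = trans M≡₁ (shift₂ n h)

  central-ratio : ∀ n → suc n * C⁻ (n + n) n ≡ n * ((n + n) C n)
  central-ratio zero    = refl
  central-ratio (suc s) =
    begin
      suc (suc s) * (suc M C s)           ≡⟨ cong (suc (suc s) *_) reflect ⟩
      suc (suc s) * (suc M C suc (suc s)) ≡⟨ absorption M (suc s) ⟩
      suc M * (M C suc s)                 ≡⟨ cong (suc M *_) (middle-symmetry M≡) ⟩
      suc M * (M C s)                     ≡⟨ sym (absorption M s) ⟩
      suc s * (suc M C suc s)             ∎
    where
    open ≡-Reasoning
    M = s + suc s
    M≡ : M ≡ s + s + 1
    M≡ = trans (+-suc s s) (+-comm 1 (s + s))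
    reflect : suc M C s ≡ suc M C suc (suc s)
    reflect = complement (sym (+-suc s (suc s)))
      where
      complement : ∀ {N} → N ≡ s + suc (suc s) → N C s ≡ N C suc (suc s)
      complement refl = trans (nCk≡nC[n∸k] (m≤m+n s (suc (suc s))))
                              (cong ((s + suc (suc s)) C_) (m+n∸m≡n s (suc (suc s))))

  catalan : ∀ n → ballot 1 n * suc n ≡ (n + n) C n
  catalan n = +-cancelˡ-≡ (n * Cn) _ _
    (begin
      n * Cn + b * suc n               ≡⟨ cong (_+ b * suc n) (sym (central-ratio n)) ⟩
      suc n * C⁻ (n + n) n + b * suc n ≡⟨ factor n (C⁻ (n + n) n) b ⟩
      suc n * (b + C⁻ (n + n) n)       ≡⟨ cong (suc n *_) (ballot-formula 0 n (n + n) (sym (+-identityʳ (n + n)))) ⟩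
      suc n * Cn                       ≡⟨ +-comm Cn (n * Cn) ⟩
      n * Cn + Cn                      ∎)
    where
    open ≡-Reasoning
    b = ballot 1 n
    Cn = (n + n) C n
    factor : ∀ n c b → suc n * c + b * suc n ≡ suc n * (b + c)
    factor = solve-∀

  Tcoeff-ballot : ∀ n → Tcoeff (suc n) ≡ ballot 1 n
  Tcoeff-ballot n =
    begin
      ((2 * n) C n) / suc n          ≡⟨ cong (λ x → ((n + x) C n) / suc n) (+-identityʳ n) ⟩
      ((n + n) C n) / suc n          ≡⟨ cong (_/ suc n) (sym (catalan n)) ⟩
      (ballot 1 n * suc n) / suc n   ≡⟨ m*n/n≡m (ballot 1 n) (suc n) ⟩
      ballot 1 n                     ∎
    where open ≡-Reasoning

open Catalan using (ballot; Tcoeff-ballot)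

total : ∀ {h} → Vec (List Tree) h → ℕ
total []       = 0
total (f ∷ fs) = sizes f + total fs

Forests : ℕ → ℕ → Set
Forests h n = Σ (Vec (List Tree) h) λ fs → total fs ≡ n

forests-≡ : ∀ {h n} {fs : Vec (List Tree) h} (p q : total fs ≡ n) → _≡_ {A = Forests h n} (fs , p) (fs , q)
forests-≡ p q = cong (_ ,_) (≡-irrelevant p q)

no-nodes : ∀ {h} (fs : Vec (List Tree) h) → total fs ≡ 0 → fs ≡ replicate h []
no-nodes []            _ = refl
no-nodes ([] ∷ fs)     p = cong ([] ∷_) (no-nodes fs p)
no-nodes ((node _ ∷ _) ∷ _) ()

total-empty : ∀ h → total (replicate h ([] {A = Tree})) ≡ 0
total-empty zero    = refl
total-empty (suc h) = total-empty h

forests-step : ∀ h n → (Forests h (suc n) ⊎ Forests (suc (suc h)) n) ↔ Forests (suc h) (suc n)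
forests-step h n = mk↔ₛ′ to from to-from from-to
  where
  to : Forests h (suc n) ⊎ Forests (suc (suc h)) n → Forests (suc h) (suc n)
  to (inj₁ (fs , p))         = [] ∷ fs , p
  to (inj₂ (g ∷ f ∷ fs , p)) = (node g ∷ f) ∷ fs , cong suc (trans (+-assoc (sizes g) _ _) p)
  from : Forests (suc h) (suc n) → Forests h (suc n) ⊎ Forests (suc (suc h)) n
  from ([] ∷ fs , p)             = inj₁ (fs , p)
  from ((node g ∷ f) ∷ fs , p) = inj₂ (g ∷ f ∷ fs , trans (sym (+-assoc (sizes g) _ _)) (suc-injective p))
  to-from : ∀ x → to (from x) ≡ x
  to-from ([] ∷ fs , p)           = refl
  to-from ((node g ∷ f) ∷ fs , p) = forests-≡ _ _
  from-to : ∀ x → from (to x) ≡ x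
  from-to (inj₁ (fs , p))         = refl
  from-to (inj₂ (g ∷ f ∷ fs , p)) = cong inj₂ (forests-≡ _ _)

forests-count : ∀ h n → Fin (ballot h n) ↔ Forests h n
forests-count zero    zero    = single↔ ([] , refl) (λ { ([] , p) → forests-≡ _ _ })
forests-count zero    (suc n) = empty↔ (λ ()) (λ { ([] , ()) })
forests-count (suc h) zero    = single↔ (replicate (suc h) [] , total-empty (suc h)) unique
  where
  unique : ∀ x → (replicate (suc h) [] , total-empty (suc h)) ≡ x
  unique (fs , p) with refl ← no-nodes fs p = forests-≡ _ _
forests-count (suc h) (suc n) =
  ↔-trans +↔⊎ (↔-trans (forests-count h (suc n) ⊎-↔ forests-count (suc (suc h)) n) (forests-step h n))

Tc : Class
Tc = mkClass Tree size (λ _ → 0)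

Tvc : Class
Tvc = mkClass Tree size size

size-positive : Positive Tc
size-positive (node _) = s≤s z≤n

trees↔forests : ∀ n → Forests 1 n ↔ Fibre Tc (suc n) 0
trees↔forests n = mk↔ₛ′
  (λ { (f ∷ [] , p) → node f , cong suc (trans (sym (+-identityʳ _)) p) , refl })
  (λ { (node f , p , _) → f ∷ [] , trans (+-identityʳ _) (suc-injective p) })
  (λ { (node f , p , refl) → fibre-≡ {Tc} refl _ _ })
  (λ { (f ∷ [] , p) → forests-≡ _ _ })

counts-T : Tz Counts Tc
counts-T n       (suc m) = empty↔ (λ ()) (λ { (_ , _ , ()) })
counts-T zero    zero    = empty↔ (λ ()) (λ { (node _ , () , _) })
counts-T (suc n) zero rewrite Tcoeff-ballot n = ↔-trans (forests-count 1 n) (trees↔forests n)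

counts-Tv : Tzv Counts Tvc
counts-Tv n m with n ≡ᵇ m in e
... | true with refl ← ≡ᵇ-true⇒≡ {n} e = ↔-trans (counts-T n 0) (mk↔ₛ′
  (λ { (t , p , _) → t , p , p }) (λ { (t , p , _) → t , p , refl })
  (λ { (t , _) → fibre-≡ {Tvc} refl _ _ }) (λ { (t , p , refl) → refl }))
... | false = empty↔ (λ ()) (λ { (t , p , q) → ≡ᵇ-false⇒≢ e (trans (sym p) q) })

attach : Tree → Tree → Tree
attach (node f) t = node (f ++ [ t ])

rdepthLast-snoc : ∀ x xs t → rdepthLast x (xs ++ [ t ]) ≡ rdepth t
rdepthLast-snoc x []       t = refl
rdepthLast-snoc x (y ∷ ys) t = rdepthLast-snoc y ys t

rdepth-attach : ∀ s t → rdepth (attach s t) ≡ suc (rdepth t)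
rdepth-attach (node [])       t = refl
rdepth-attach (node (x ∷ xs)) t = cong suc (rdepthLast-snoc x xs t)

sizes-snoc : ∀ f t → sizes (f ++ [ t ]) ≡ sizes f + size t
sizes-snoc []      t = +-identityʳ (size t)
sizes-snoc (x ∷ f) t = trans (cong (size x +_) (sizes-snoc f t)) (sym (+-assoc (size x) _ _))

size-attach : ∀ s t → size (attach s t) ≡ size s + size t
size-attach (node f) t = cong suc (sizes-snoc f t)

cutLast-snoc : ∀ j x xs t → cutLast j x (xs ++ [ t ]) ≡ x ∷ xs ++ [ cut j t ]
cutLast-snoc j x []       t = refl
cutLast-snoc j x (y ∷ ys) t = cong (x ∷_) (cutLast-snoc j y ys t)

cut-attach : ∀ j s t → cut (suc j) (attach s t) ≡ attach s (cut j t)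
cut-attach j (node [])       t = refl
cut-attach j (node (x ∷ xs)) t = cong node (cutLast-snoc j x xs t)

-- The spine decomposition: a tree is determined by the list of "left parts"
-- along its rightmost path, each left part being the node with its rightmost
-- child removed.  spine rebuilds a tree from its left parts, unspine reads them off.
spine : List Tree → Tree
spine []       = leaf
spine (s ∷ ss) = attach s (spine ss)

mutual
  unspine : Tree → List Tree
  unspine (node [])       = []
  unspine (node (t ∷ ts)) = unspineLast [] t ts

  -- the left parts of node (acc ++ t ∷ ts)
  unspineLast : List Tree → Tree → List Tree → List Tree
  unspineLast acc t []       = node acc ∷ unspine t
  unspineLast acc t (u ∷ us) = unspineLast (acc ++ [ t ]) u us

mutual
  spine-unspine : ∀ c → spine (unspine c) ≡ c
  spine-unspine (node [])       = refl
  spine-unspine (node (t ∷ ts)) = spine-unspineLast [] t ts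

  spine-unspineLast : ∀ acc t ts → spine (unspineLast acc t ts) ≡ node (acc ++ t ∷ ts)
  spine-unspineLast acc t []       = cong (λ x → node (acc ++ [ x ])) (spine-unspine t)
  spine-unspineLast acc t (u ∷ us) =
    trans (spine-unspineLast (acc ++ [ t ]) u us) (cong node (++-assoc acc [ t ] (u ∷ us)))

unspineLast-snoc : ∀ acc x f t → unspineLast acc x (f ++ [ t ]) ≡ node (acc ++ x ∷ f) ∷ unspine t
unspineLast-snoc acc x []      t = refl
unspineLast-snoc acc x (y ∷ f) t =
  trans (unspineLast-snoc (acc ++ [ x ]) y f t) (cong (λ z → node z ∷ unspine t) (++-assoc acc [ x ] (y ∷ f)))

unspine-attach : ∀ s t → unspine (attach s t) ≡ s ∷ unspine t
unspine-attach (node [])      t = refl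
unspine-attach (node (x ∷ f)) t = unspineLast-snoc [] x f t

unspine-spine : ∀ ss → unspine (spine ss) ≡ ss
unspine-spine []       = refl
unspine-spine (s ∷ ss) = trans (unspine-attach s (spine ss)) (cong (s ∷_) (unspine-spine ss))

rdepth-spine : ∀ ss → rdepth (spine ss) ≡ length ss
rdepth-spine []       = refl
rdepth-spine (s ∷ ss) = trans (rdepth-attach s (spine ss)) (cong suc (rdepth-spine ss))

size-spine : ∀ ss → size (spine ss) ≡ suc (sizes ss)
size-spine []       = refl
size-spine (s ∷ ss) = trans (size-attach s (spine ss)) (trans (cong (size s +_) (size-spine ss)) (+-suc (size s) _))

cut-spine : ∀ ss ts → cut (length ss) (spine (ss ++ ts)) ≡ spine ss
cut-spine []       ts = refl
cut-spine (s ∷ ss) ts = trans (cut-attach (length ss) s (spine (ss ++ ts))) (cong (attach s) (cut-spine ss ts))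

reduceBranch^ : ℕ → Tree → Maybe Tree
reduceBranch^ zero    c = just c
reduceBranch^ (suc r) c = reduceBranch^ r c >>= reduceBranch

reducedSize : ℕ → Tree → ℕ
reducedSize r c = maybe size 0 (reduceBranch^ r c)

mapMaybe-fuse : ∀ (f g : Tree → Maybe Tree) xs → mapMaybe g (mapMaybe f xs) ≡ mapMaybe (λ x → f x >>= g) xs
mapMaybe-fuse f g []       = refl
mapMaybe-fuse f g (x ∷ xs) with f x
... | nothing = mapMaybe-fuse f g xs
... | just y with g y
...   | nothing = mapMaybe-fuse f g xs
...   | just z  = cong (z ∷_) (mapMaybe-fuse f g xs)

mapMaybe-just : ∀ (xs : List Tree) → mapMaybe just xs ≡ xs
mapMaybe-just []       = refl
mapMaybe-just (x ∷ xs) = cong (x ∷_) (mapMaybe-just xs)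

ρ^-node : ∀ r cs → ρ^ r (node cs) ≡ node (mapMaybe (reduceBranch^ r) cs)
ρ^-node zero    cs = cong node (sym (mapMaybe-just cs))
ρ^-node (suc r) cs = trans (cong ρ (ρ^-node r cs)) (cong node (mapMaybe-fuse (reduceBranch^ r) reduceBranch cs))

sizes-mapMaybe : ∀ r cs → sizes (mapMaybe (reduceBranch^ r) cs) ≡ sum (map (reducedSize r) cs)
sizes-mapMaybe r []       = refl
sizes-mapMaybe r (c ∷ cs) with reduceBranch^ r c
... | nothing = sizes-mapMaybe r cs
... | just t  = cong (size t +_) (sizes-mapMaybe r cs)

size-ρ^ : ∀ r cs → size (ρ^ r (node cs)) ≡ suc (sum (map (reducedSize r) cs))
size-ρ^ r cs = trans (cong size (ρ^-node r cs)) (cong suc (sizes-mapMaybe r cs))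

initLast-∷ʳ : ∀ {X : Set} (xs : List X) x → initLast (xs ∷ʳ x) ≡ (xs ∷ʳ′ x)
initLast-∷ʳ []       x = refl
initLast-∷ʳ (y ∷ ys) x rewrite initLast-∷ʳ ys x = refl

module TailSplit (C : Class) where
  open Sequences C

  Short : ℕ → Set
  Short r = Carrier (sumC r (powC C))

  shortToList : ∀ r → Short r → List (Carrier C)
  shortToList (suc r) (inj₁ s)  = shortToList r s
  shortToList (suc r) (inj₂ xs) = powToList r xs

  Split : ℕ → Set
  Split r = Short r ⊎ (List (Carrier C) × Carrier (powC C r))

  join : ∀ r → Split r → List (Carrier C)
  join r (inj₁ s)            = shortToList r s
  join r (inj₂ (pre , post)) = pre ++ powToList r post

  split : ∀ r → List (Carrier C) → Split r
  split zero    xs = inj₂ (xs , tt)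
  split (suc r) xs with split r xs
  ... | inj₁ s            = inj₁ (inj₁ s)
  ... | inj₂ (pre , post) with initLast pre
  ...   | []            = inj₁ (inj₂ post)
  ...   | pre′ ∷ʳ′ x    = inj₂ (pre′ , (x , post))

  join-split : ∀ r xs → join r (split r xs) ≡ xs
  join-split zero    xs = ++-identityʳ xs
  join-split (suc r) xs with split r xs | join-split r xs
  ... | inj₁ s            | ih = ih
  ... | inj₂ (pre , post) | ih with initLast pre
  ...   | []         = ih
  ...   | pre′ ∷ʳ′ x = trans (sym (++-assoc pre′ [ x ] (powToList r post))) ih

  split-join : ∀ r s → split r (join r s) ≡ s
  split-join zero    (inj₂ (xs , tt)) = cong (λ ys → inj₂ (ys , tt)) (++-identityʳ xs)
  split-join (suc r) (inj₁ (inj₁ s))  rewrite split-join r (inj₁ s) = refl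
  split-join (suc r) (inj₁ (inj₂ xs)) rewrite split-join r (inj₂ ([] , xs)) = refl
  split-join (suc r) (inj₂ (pre , (x , post)))
    rewrite sym (++-assoc pre [ x ] (powToList r post))
          | split-join r (inj₂ (pre ∷ʳ x , post))
          | initLast-∷ʳ pre x = refl

  length-shortToList : ∀ r s → length (shortToList r s) < r
  length-shortToList (suc r) (inj₁ s)  = m<n⇒m<1+n (length-shortToList r s)
  length-shortToList (suc r) (inj₂ xs) = s≤s (≤-reflexive (length-powToList r xs))

  zw-shortToList : ∀ r s → zw (listC C) (shortToList r s) ≡ zw (sumC r (powC C)) s
  zw-shortToList (suc r) (inj₁ s)  = zw-shortToList r s
  zw-shortToList (suc r) (inj₂ xs) = zw-powToList r xs

-- A branch c of a Catalan--Stanley tree has its rightmost leaf at odd distance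
-- 1 + rdepth c from the root, i.e. an even number of left parts along its spine.
OddBranch : Tree → Set
OddBranch c = suc (rdepth c) % 2 ≡ 1

Pair : Set
Pair = Tree × Tree

flatten : List Pair → List Tree
flatten []             = []
flatten ((a , b) ∷ ps) = a ∷ b ∷ flatten ps

flatten-++ : ∀ ps qs → flatten (ps ++ qs) ≡ flatten ps ++ flatten qs
flatten-++ []             qs = refl
flatten-++ ((a , b) ∷ ps) qs = cong (λ ts → a ∷ b ∷ ts) (flatten-++ ps qs)

odd-flatten : ∀ ps → suc (length (flatten ps)) % 2 ≡ 1
odd-flatten []             = refl
odd-flatten ((a , b) ∷ ps) = odd-flatten ps

pairUp : (ts : List Tree) → suc (length ts) % 2 ≡ 1 → List Pair
pairUp []           _ = []
pairUp (a ∷ [])     ()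
pairUp (a ∷ b ∷ ts) p = (a , b) ∷ pairUp ts p

pairUp-flatten : ∀ ps p → pairUp (flatten ps) p ≡ ps
pairUp-flatten []             _ = refl
pairUp-flatten ((a , b) ∷ ps) p = cong ((a , b) ∷_) (pairUp-flatten ps p)

flatten-pairUp : ∀ ts p → flatten (pairUp ts p) ≡ ts
flatten-pairUp []           _ = refl
flatten-pairUp (a ∷ [])     ()
flatten-pairUp (a ∷ b ∷ ts) p = cong (λ us → a ∷ b ∷ us) (flatten-pairUp ts p)

pairBranch : List Pair → Tree
pairBranch ps = spine (flatten ps)

pairs : (c : Tree) → OddBranch c → List Pair
pairs c odd = pairUp (unspine c) (subst (λ d → suc d % 2 ≡ 1) depth odd)
  where
  depth : rdepth c ≡ length (unspine c)
  depth = trans (cong rdepth (sym (spine-unspine c))) (rdepth-spine (unspine c))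

odd-pairBranch : ∀ ps → OddBranch (pairBranch ps)
odd-pairBranch ps = subst (λ d → suc d % 2 ≡ 1) (sym (rdepth-spine (flatten ps))) (odd-flatten ps)

pairBranch-pairs : ∀ c odd → pairBranch (pairs c odd) ≡ c
pairBranch-pairs c odd = trans (cong spine (flatten-pairUp (unspine c) _)) (spine-unspine c)

pairs-pairBranch : ∀ ps odd → pairs (pairBranch ps) odd ≡ ps
pairs-pairBranch ps odd = trans (pairUp-cong (unspine-spine (flatten ps))) (pairUp-flatten ps (odd-flatten ps))
  where
  pairUp-cong : ∀ {ts us} → ts ≡ us → ∀ {p q} → pairUp ts p ≡ pairUp us q
  pairUp-cong {ts} refl = cong (pairUp ts) (≡-irrelevant _ _)

-- One reduction removes the last pair: the grandparent of the rightmost leaf is the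
-- spine node reached after the earlier pairs, and everything below it is cut away.
reduceBranch-deep : ∀ c k → rdepth c ≡ suc k → reduceBranch c ≡ just (cut (suc k ∸ 2) c)
reduceBranch-deep c k e with rdepth c
reduceBranch-deep c k refl | .(suc k) = refl

reduce-pairBranch : ∀ ps p → reduceBranch (pairBranch (ps ∷ʳ p)) ≡ just (pairBranch ps)
reduce-pairBranch ps (a , b) =
  trans (reduceBranch-deep _ (suc (length (flatten ps))) depth)
        (cong just (trans (cong (λ ts → cut (length (flatten ps)) (spine ts)) (flatten-++ ps [ a , b ]))
                          (cut-spine (flatten ps) _)))
  where
  depth : rdepth (pairBranch (ps ∷ʳ (a , b))) ≡ suc (suc (length (flatten ps)))
  depth = trans (rdepth-spine (flatten (ps ∷ʳ (a , b))))
         (trans (cong length (flatten-++ ps [ a , b ]))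
         (trans (length-++ (flatten ps)) (+-comm (length (flatten ps)) 2)))

reduce^-pairBranch : ∀ r pre post → length post ≡ r →
                     reduceBranch^ r (pairBranch (pre ++ post)) ≡ just (pairBranch pre)
reduce^-pairBranch _ pre []         refl = cong (λ ps → just (pairBranch ps)) (++-identityʳ pre)
reduce^-pairBranch _ pre (p ∷ post) refl
  rewrite sym (++-assoc pre [ p ] post)
        | reduce^-pairBranch (length post) (pre ∷ʳ p) post refl = reduce-pairBranch pre p

reduce^-nothing : ∀ d k c → reduceBranch^ k c ≡ nothing → reduceBranch^ (d + k) c ≡ nothing
reduce^-nothing zero    k c e = e
reduce^-nothing (suc d) k c e rewrite reduce^-nothing d k c e = refl

reduce^-short : ∀ r ps → length ps < r → reduceBranch^ r (pairBranch ps) ≡ nothing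
reduce^-short r ps lt = subst (λ k → reduceBranch^ k (pairBranch ps) ≡ nothing) (m∸n+n≡m lt)
  (reduce^-nothing (r ∸ suc (length ps)) (suc (length ps)) (pairBranch ps) deleted)
  where
  deleted : reduceBranch^ (suc (length ps)) (pairBranch ps) ≡ nothing
  deleted rewrite reduce^-pairBranch (length ps) [] ps refl = refl

BranchC : ℕ → Class
BranchC r = mkClass (Σ Tree OddBranch) (λ b → size (proj₁ b)) (λ b → reducedSize r (proj₁ b))

PairsC : ℕ → Class
PairsC r = mkClass (List Pair) (λ ps → size (pairBranch ps)) (λ ps → reducedSize r (pairBranch ps))

Pairs≅Branch : ∀ r → PairsC r ≅ BranchC r
Pairs≅Branch r = mk≅ (λ ps → pairBranch ps , odd-pairBranch ps) (λ { (c , odd) → pairs c odd })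
  (λ { (c , odd) → Σ-≡ (pairBranch-pairs c odd) })
  (λ ps → pairs-pairBranch ps _)
  (λ _ → refl) (λ _ → refl)
  where
  Σ-≡ : ∀ {c d} {p : OddBranch c} {q : OddBranch d} → c ≡ d → _≡_ {A = Σ Tree OddBranch} (c , p) (d , q)
  Σ-≡ {c} refl = cong (c ,_) (≡-irrelevant _ _)

Zc Vc ZVc : Class
Zc  = unitC 1 0
Vc  = unitC 0 1
ZVc = unitC 1 1

TTc TTv : Class
TTc = Tc ×C Tc
TTv = Tvc ×C Tvc

sizes-flatten : ∀ ps → sizes (flatten ps) ≡ zw (listC TTc) ps
sizes-flatten []             = refl
sizes-flatten ((a , b) ∷ ps) =
  trans (sym (+-assoc (size a) (size b) _)) (cong (size a + size b +_) (sizes-flatten ps))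

vw-pow-TTc : ∀ k xs → vw (powC TTc k) xs ≡ 0
vw-pow-TTc zero    tt       = refl
vw-pow-TTc (suc k) (x , xs) = vw-pow-TTc k xs

vw-sum-TTc : ∀ r s → vw (sumC r (powC TTc)) s ≡ 0
vw-sum-TTc (suc r) (inj₁ s)  = vw-sum-TTc r s
vw-sum-TTc (suc r) (inj₂ xs) = vw-pow-TTc r xs

size-pairBranch : ∀ ps → size (pairBranch ps) ≡ suc (zw (listC TTc) ps)
size-pairBranch ps = trans (size-spine (flatten ps)) (cong suc (sizes-flatten ps))

reducedSize-short : ∀ r ps → length ps < r → reducedSize r (pairBranch ps) ≡ 0
reducedSize-short r ps short = cong (maybe size 0) (reduce^-short r ps short)

reducedSize-long : ∀ r pre post → length post ≡ r →
                   reducedSize r (pairBranch (pre ++ post)) ≡ suc (zw (listC TTc) pre)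
reducedSize-long r pre post len = trans (cong (maybe size 0) (reduce^-pairBranch r pre post len)) (size-pairBranch pre)

-- A branch with fewer than r pairs (it vanishes under ρ^r, contributing only z),
-- or a list of pairs followed by the last r pairs (which are cut away, leaving
-- the branch root, marked by v, and the earlier pairs, counted in z and v).
ShortC LongC : ℕ → Class
ShortC r = Zc ×C sumC r (powC TTc)
LongC  r = (Zc ×C powC TTc r) ×C Vc ×C listC TTv

Short⊎Long≅Pairs : ∀ r → ShortC r ⊎C LongC r ≅ PairsC r
Short⊎Long≅Pairs r = mk≅ to from to-from from-to zw-to vw-to
  where
  open TailSplit TTc
  open Sequences TTc using (powToList; length-powToList; zw-powToList)
  toSplit : Carrier (ShortC r ⊎C LongC r) → Split r
  toSplit (inj₁ (tt , s))                      = inj₁ s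
  toSplit (inj₂ (((tt , post) , tt) , pre)) = inj₂ (pre , post)
  fromSplit : Split r → Carrier (ShortC r ⊎C LongC r)
  fromSplit (inj₁ s)            = inj₁ (tt , s)
  fromSplit (inj₂ (pre , post)) = inj₂ (((tt , post) , tt) , pre)
  to : Carrier (ShortC r ⊎C LongC r) → List Pair
  to x = join r (toSplit x)
  from : List Pair → Carrier (ShortC r ⊎C LongC r)
  from ps = fromSplit (split r ps)
  to-from : ∀ ps → to (from ps) ≡ ps
  to-from ps with split r ps | join-split r ps
  ... | inj₁ _ | e = e
  ... | inj₂ _ | e = e
  from-to : ∀ x → from (to x) ≡ x
  from-to (inj₁ (tt , s))                    = cong fromSplit (split-join r (inj₁ s))
  from-to (inj₂ (((tt , post) , tt) , pre)) = cong fromSplit (split-join r (inj₂ (pre , post)))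
  zw-to : ∀ x → size (pairBranch (to x)) ≡ zw (ShortC r ⊎C LongC r) x
  zw-to (inj₁ (tt , s)) = trans (size-pairBranch (shortToList r s)) (cong suc (zw-shortToList r s))
  zw-to (inj₂ (((tt , post) , tt) , pre)) =
    begin
      size (pairBranch (pre ++ powToList r post))
        ≡⟨ size-pairBranch (pre ++ powToList r post) ⟩
      suc (zw (listC TTc) (pre ++ powToList r post))
        ≡⟨ cong suc (zw-++ TTc pre (powToList r post)) ⟩
      suc (zw (listC TTc) pre + zw (listC TTc) (powToList r post))
        ≡⟨ cong (λ w → suc (zw (listC TTc) pre + w)) (zw-powToList r post) ⟩
      suc (zw (listC TTc) pre + zw (powC TTc r) post)
        ≡⟨ reorder (zw (listC TTc) pre) (zw (powC TTc r) post) ⟩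
      1 + zw (powC TTc r) post + 0 + zw (listC TTc) pre
        ∎
    where
    open ≡-Reasoning
    reorder : ∀ l p → suc (l + p) ≡ 1 + p + 0 + l
    reorder = solve-∀
  vw-to : ∀ x → reducedSize r (pairBranch (to x)) ≡ vw (ShortC r ⊎C LongC r) x
  vw-to (inj₁ (tt , s)) =
    trans (reducedSize-short r (shortToList r s) (length-shortToList r s)) (sym (vw-sum-TTc r s))
  vw-to (inj₂ (((tt , post) , tt) , pre)) =
    trans (reducedSize-long r pre (powToList r post) (length-powToList r post))
          (cong (λ w → w + 1 + zw (listC TTc) pre) (sym (vw-pow-TTc r post)))

CatalanStanleyC : ℕ → Class
CatalanStanleyC r = mkClass (Σ Tree CatalanStanley) (λ τ → size (proj₁ τ)) (λ τ → size (ρ^ r (proj₁ τ)))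

-- A Catalan--Stanley tree is a root (of weight zv, as it survives every reduction)
-- with a sequence of odd branches, and ρ^r acts on each branch separately.
root-decomposition : ∀ r → ZVc ×C listC (BranchC r) ≅ CatalanStanleyC r
root-decomposition r = mk≅ to from to-from from-to zw-to vw-to
  where
  collect : List (Σ Tree OddBranch) → Σ (List Tree) (All OddBranch)
  collect []             = [] , []
  collect ((c , o) ∷ bs) = c ∷ proj₁ (collect bs) , o ∷ proj₂ (collect bs)
  separate : (cs : List Tree) → All OddBranch cs → List (Σ Tree OddBranch)
  separate []       []       = []
  separate (c ∷ cs) (o ∷ os) = (c , o) ∷ separate cs os
  to : Carrier (ZVc ×C listC (BranchC r)) → Σ Tree CatalanStanley
  to (tt , bs) = node (proj₁ (collect bs)) , proj₂ (collect bs)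
  from : Σ Tree CatalanStanley → Carrier (ZVc ×C listC (BranchC r))
  from (node cs , os) = tt , separate cs os
  collect-separate : ∀ cs os → collect (separate cs os) ≡ (cs , os)
  collect-separate []       []       = refl
  collect-separate (c ∷ cs) (o ∷ os) = cong (λ { (cs , os) → c ∷ cs , o ∷ os }) (collect-separate cs os)
  separate-collect : ∀ bs → separate (proj₁ (collect bs)) (proj₂ (collect bs)) ≡ bs
  separate-collect []             = refl
  separate-collect ((c , o) ∷ bs) = cong ((c , o) ∷_) (separate-collect bs)
  to-from : ∀ τ → to (from τ) ≡ τ
  to-from (node cs , os) = cong (λ { (cs , os) → node cs , os }) (collect-separate cs os)
  from-to : ∀ x → from (to x) ≡ x
  from-to (tt , bs) = cong (tt ,_) (separate-collect bs)
  zw-collect : ∀ bs → sizes (proj₁ (collect bs)) ≡ zw (listC (BranchC r)) bs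
  zw-collect []             = refl
  zw-collect ((c , o) ∷ bs) = cong (size c +_) (zw-collect bs)
  vw-collect : ∀ bs → sum (map (reducedSize r) (proj₁ (collect bs))) ≡ vw (listC (BranchC r)) bs
  vw-collect []             = refl
  vw-collect ((c , o) ∷ bs) = cong (reducedSize r c +_) (vw-collect bs)
  zw-to : ∀ x → size (proj₁ (to x)) ≡ zw (ZVc ×C listC (BranchC r)) x
  zw-to (tt , bs) = cong suc (zw-collect bs)
  vw-to : ∀ x → size (ρ^ r (proj₁ (to x))) ≡ vw (ZVc ×C listC (BranchC r)) x
  vw-to (tt , bs) = trans (size-ρ^ r (proj₁ (collect bs))) (cong suc (vw-collect bs))

Ac : ℕ → Class
Ac r = sumC r (λ j → powC Tc (2 * j))

Qc : ℕ → Class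
Qc r = listC (Zc ×C Ac r)

Wc : ℕ → Class
Wc r = (Zc ×C powC Tc (2 * r)) ×C Qc r ×C Vc

Sc : ℕ → Class
Sc r = ZVc ⊎C ZVc ×C Wc r ×C listC (Wc r ⊎C TTv)

RHSc : ℕ → Class
RHSc r = Qc r ×C Sc r

counts-Q : ∀ r → Q r Counts Qc r
counts-Q r = counts-list (λ { (tt , _) → s≤s z≤n })
  (counts-× (counts-unit 1 0) (counts-sum (λ j → counts-pow counts-T (2 * j)) r))

counts-W : ∀ r → Z ⊗ (Tz ^ᵖ (2 * r)) ⊗ Q r ⊗ V Counts Wc r
counts-W r =
  counts-× (counts-× (counts-× (counts-unit 1 0) (counts-pow counts-T (2 * r))) (counts-Q r)) (counts-unit 0 1)

counts-RHS : ∀ r → RHS r Counts RHSc r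
counts-RHS r = counts-× (counts-Q r)
  (counts-⊎ (counts-unit 1 1)
    (counts-× (counts-× (counts-unit 1 1) (counts-W r))
      (counts-list positive (counts-⊎ (counts-W r) (counts-× counts-Tv counts-Tv)))))
  where
  positive : Positive (Wc r ⊎C TTv)
  positive (inj₁ _)       = s≤s z≤n
  positive (inj₂ (a , b)) = ≤-trans (size-positive a) (m≤m+n (size a) (size b))

-- Odd branches, with the pairs of left parts read as T^2-factors:
-- short ones contribute z A_r, long ones z T^{2r} v SEQ(T(zv)^2).
LongBranchC : ℕ → Class
LongBranchC r = (Zc ×C powC Tc (2 * r)) ×C Vc ×C listC TTv

branches : ∀ r → Zc ×C Ac r ⊎C LongBranchC r ≅ BranchC r
branches r = ≅-trans (⊎-cong (×-cong (≅-refl {Zc}) (sum-cong (λ j → ≅-sym (pow-pairs {Tc} j)) r))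
                             (×-cong (×-cong (×-cong (≅-refl {Zc}) (≅-sym (pow-pairs {Tc} r))) (≅-refl {Vc}))
                                     (≅-refl {listC TTv})))
             (≅-trans (Short⊎Long≅Pairs r) (Pairs≅Branch r))

-- A long branch followed by a run of short ones is W_r × SEQ(T(zv)^2).
absorb-run : ∀ {A V L Q} → A ×C V ×C L ×C Q ≅ A ×C Q ×C V ×C L
absorb-run {A} {V} {L} {Q} = mk≅ (λ { (((a , v) , l) , q) → ((a , q) , v) , l })
  (λ { (((a , q) , v) , l) → ((a , v) , l) , q }) (λ _ → refl) (λ _ → refl)
  (λ { (((a , v) , l) , q) → rearrange (zw A a) (zw V v) (zw L l) (zw Q q) })
  (λ { (((a , v) , l) , q) → rearrange (vw A a) (vw V v) (vw L l) (vw Q q) })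
  where
  rearrange : ∀ a v l q → a + q + v + l ≡ a + v + l + q
  rearrange = solve-∀

distribute : ∀ {Q W L} → ZVc ×C (Q ×C (unitC 0 0 ⊎C W ×C L)) ≅ Q ×C (ZVc ⊎C ZVc ×C W ×C L)
distribute {Q} {W} {L} = mk≅
  (λ { (tt , q , inj₁ tt) → q , inj₁ tt ; (tt , q , inj₂ (w , l)) → q , inj₂ ((tt , w) , l) })
  (λ { (q , inj₁ tt) → tt , q , inj₁ tt ; (q , inj₂ ((tt , w) , l)) → tt , q , inj₂ (w , l) })
  (λ { (q , inj₁ tt) → refl ; (q , inj₂ ((tt , w) , l)) → refl })
  (λ { (tt , q , inj₁ tt) → refl ; (tt , q , inj₂ (w , l)) → refl })
  (λ { (tt , q , inj₁ tt) → root (zw Q q) ; (tt , q , inj₂ (w , l)) → root-with (zw Q q) (zw W w) (zw L l) })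
  (λ { (tt , q , inj₁ tt) → root (vw Q q) ; (tt , q , inj₂ (w , l)) → root-with (vw Q q) (vw W w) (vw L l) })
  where
  root : ∀ q → q + 1 ≡ 1 + (q + 0)
  root = solve-∀
  root-with : ∀ q w l → q + (1 + w + l) ≡ 1 + (q + (w + l))
  root-with = solve-∀

-- Read upwards from the trees: the
-- branch sequence is cut into runs of short branches separated by long ones, each
-- long branch absorbs the run after it (giving W_r × SEQ(T(zv)^2)), and the sequence
-- of these blocks is expanded as 1 + W_r × SEQ(W_r + T(zv)^2).
RHS≅CatalanStanley : ∀ r → RHSc r ≅ CatalanStanleyC r
RHS≅CatalanStanley r =
  Qc r ×C (ZVc ⊎C ZVc ×C Wc r ×C listC (Wc r ⊎C TTv))
    ≅⟨ ≅-sym (distribute {Qc r} {Wc r} {listC (Wc r ⊎C TTv)}) ⟩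
  ZVc ×C (Qc r ×C (unitC 0 0 ⊎C Wc r ×C listC (Wc r ⊎C TTv)))
    ≅⟨ in-sequence (⊎-cong (≅-refl {unitC 0 0}) (group (Wc r) TTv)) ⟩
  ZVc ×C (Qc r ×C (unitC 0 0 ⊎C (Wc r ×C listC TTv) ×C listC (Wc r ×C listC TTv)))
    ≅⟨ in-sequence (list-unfold {Wc r ×C listC TTv}) ⟩
  ZVc ×C (Qc r ×C listC (Wc r ×C listC TTv))
    ≅⟨ in-sequence (list-cong (≅-sym (absorb-run {Zc ×C powC Tc (2 * r)} {Vc} {listC TTv} {Qc r}))) ⟩
  ZVc ×C (Qc r ×C listC (LongBranchC r ×C Qc r))
    ≅⟨ below-root (list-⊎ (Zc ×C Ac r) (LongBranchC r)) ⟩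
  ZVc ×C listC (Zc ×C Ac r ⊎C LongBranchC r)
    ≅⟨ below-root (list-cong (branches r)) ⟩
  ZVc ×C listC (BranchC r)
    ≅⟨ root-decomposition r ⟩
  CatalanStanleyC r ∎
  where
  open ≅-Reasoning
  below-root : ∀ {A B} → A ≅ B → ZVc ×C A ≅ ZVc ×C B
  below-root = ×-cong (≅-refl {ZVc})
  in-sequence : ∀ {A B} → A ≅ B → ZVc ×C (Qc r ×C A) ≅ ZVc ×C (Qc r ×C B)
  in-sequence e = below-root (×-cong (≅-refl {Qc r}) e)

mainTheorem6 : (r n m : ℕ) → Fin (RHS r n m) ↔ GrSet r n m
mainTheorem6 r n m = ↔-trans (counts-≅ (counts-RHS r) (RHS≅CatalanStanley r) n m) fibre↔GrSet
  where
  fibre↔GrSet : Fibre (CatalanStanleyC r) n m ↔ GrSet r n m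
  fibre↔GrSet = mk↔ₛ′ (λ { ((τ , cs) , p) → τ , cs , p }) (λ { (τ , cs , p) → (τ , cs) , p })
                      (λ _ → refl) (λ _ → refl)
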